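{- Consider the construction described in the context. If there is a set $S\subseteq V(G')$ with $|S|\le k$ such that for every $\{x,y\}\in\mathcal{T}$ there is $w\in S$ with $d(x,w)+d(w,y)\le(1+\alpha)\,d(x,y)$, then there is such a set $S^*$ (also of size at most $k$ with the same property) which is nice, i.e. $|S^*\cap U_i|=1$ for every $i\in[k]$ and $S^*=\bigcup_{i\in[k]}(S^*\cap U_i)$, where $U_i=\{u_{i,1},\dots,u_{i,n}\}$.
   Context: Let $G$ be a graph whose vertex set is partitioned into $V_1,\dots,V_k$ with $V_i=\{v_{i,1},\dots,v_{i,n}\}$, $n$ odd. Fix rational $\alpha$ with $0<\alpha\le 0.5$, and set $L=\lceil n/(2\alpha)\rceil$, $L_p=\lceil (n-1)/\alpha\rceil$. The graph $G'$ (unweighted; $d$ denotes its shortest-path distance) is built as follows: a vertex $b$; for each $i\in[k]$: vertices $u'_{i,1},\dots,u'_{i,n}$ forming a path in this order, vertices $u_{i,1},\dots,u_{i,n}$ forming a path in this order, a vertex $z_i$ adjacent to $u'_{i,1}$ and $u_{i,n}$, a vertex $z'_i$ adjacent to $u'_{i,n}$ and $u_{i,1}$, and a vertex $p_i$ joined to $u_{i,(n+1)/2}$ by a path with $L_p-1$ new internal vertices; for each $i\in[k]$, $j\in[n]$: a path from $u_{i,j}$ to $b$ with $L-1$ new internal vertices and a path from $u'_{i,j}$ to $b$ with $L-1$ new internal vertices. The terminal set $\mathcal{T}$ consists of $\{p_i,u_{i,(n+1)/2}\}$ for each $i\in[k]$, together with, for all $i<j$ in $[k]$, the pairs $\{u'_{i,i'},u'_{j,j'}\}$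 for all $i',j'\in[n]$ with $v_{i,i'}v_{j,j'}\in E(G)$. -}

module Defs where

open import Data.Nat using (ℕ; zero; suc; _+_; _*_; _∸_; _≤_; _<_; ⌊_/2⌋)
open import Data.Nat.DivMod using (_/_)
open import Data.Fin using (Fin; toℕ; fromℕ)
open import Data.Product using (Σ; ∃; ∃-syntax; _×_; _,_)
open import Data.Sum using (_⊎_)
open import Relation.Binary.PropositionalEquality using (_≡_)
open import Data.List using (List)
open import Data.List.Membership.Propositional using (_∈_)

-- Ceiling of a / b for b > 0 (value at b = 0 is irrelevant: only used with b > 0).
ceilDiv : ℕ → ℕ → ℕ
ceilDiv a zero    = zero
ceilDiv a (suc b) = (a + b) / suc b

-- Indices are 0-based: u i j stands for u_{i+1,j+1}.
-- The p-path from u_{i,(n+1)/2} to p_i has Lp edges; its vertices other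
-- than u_{i,(n+1)/2} are  pin i t  (t : Fin Lp) at distance t+1, so that
-- p_i = pin i (Lp-1) (and p_i = u_{i,(n+1)/2} in the degenerate case Lp = 0).
-- The spoke from u_{i,j} (resp. u'_{i,j}) to b has L edges; its L-1
-- internal vertices are  su i j t  (resp. su' i j t), t : Fin (L ∸ 1),
-- su i j t at distance t+1 from u_{i,j}.

data V (k n L Lp : ℕ) : Set where
  b       : V k n L Lp
  u u'    : Fin k → Fin n → V k n L Lp
  z z'    : Fin k → V k n L Lp
  pin     : Fin k → Fin Lp → V k n L Lp
  su su'  : Fin k → Fin n → Fin (L ∸ 1) → V k n L Lp

-- p_i, given the index j of the middle vertex u_{i,(n+1)/2}
pEnd : ∀ {k n L} Lp → Fin k → Fin n → V k n L Lp
pEnd zero     i j = u i j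
pEnd (suc m)  i j = pin i (fromℕ m)

module _ {k n L Lp : ℕ} where

  -- oriented edge list of G' (each undirected edge listed once)
  data E : V k n L Lp → V k n L Lp → Set where
    e-u'  : ∀ i (j j' : Fin n) → suc (toℕ j) ≡ toℕ j' → E (u' i j) (u' i j')
    e-u   : ∀ i (j j' : Fin n) → suc (toℕ j) ≡ toℕ j' → E (u i j) (u i j')
    e-z₁  : ∀ i (j : Fin n) → toℕ j ≡ 0 → E (z i) (u' i j)
    e-z₂  : ∀ i (j : Fin n) → suc (toℕ j) ≡ n → E (z i) (u i j)
    e-z'₁ : ∀ i (j : Fin n) → suc (toℕ j) ≡ n → E (z' i) (u' i j)
    e-z'₂ : ∀ i (j : Fin n) → toℕ j ≡ 0 → E (z' i) (u i j)
    e-p₀  : ∀ i (j : Fin n) (t : Fin Lp) → toℕ j ≡ ⌊ n /2⌋ → toℕ t ≡ 0 →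
            E (u i j) (pin i t)
    e-p   : ∀ i (t t' : Fin Lp) → suc (toℕ t) ≡ toℕ t' → E (pin i t) (pin i t')
    e-s₀  : ∀ i j (t : Fin (L ∸ 1)) → toℕ t ≡ 0 → E (u i j) (su i j t)
    e-s   : ∀ i j (t t' : Fin (L ∸ 1)) → suc (toℕ t) ≡ toℕ t' → E (su i j t) (su i j t')
    e-sb  : ∀ i j (t : Fin (L ∸ 1)) → suc (toℕ t) ≡ L ∸ 1 → E (su i j t) b
    e-ub  : ∀ i j → L ≡ 1 → E (u i j) b
    e-s'₀ : ∀ i j (t : Fin (L ∸ 1)) → toℕ t ≡ 0 → E (u' i j) (su' i j t)
    e-s'  : ∀ i j (t t' : Fin (L ∸ 1)) → suc (toℕ t) ≡ toℕ t' → E (su' i j t) (su' i j t')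
    e-s'b : ∀ i j (t : Fin (L ∸ 1)) → suc (toℕ t) ≡ L ∸ 1 → E (su' i j t) b
    e-u'b : ∀ i j → L ≡ 1 → E (u' i j) b

  Adj : V k n L Lp → V k n L Lp → Set
  Adj x y = E x y ⊎ E y x

  data Walk : V k n L Lp → V k n L Lp → ℕ → Set where
    [] : ∀ {x} → Walk x x 0
    _∷_ : ∀ {x y w m} → Adj x y → Walk y w m → Walk x w (suc m)

  Dist : V k n L Lp → V k n L Lp → ℕ → Set
  Dist x y m = Walk x y m × (∀ m' → Walk x y m' → m ≤ m')

  -- terminal pairs; G is given by its edge relation EG on
  -- V(G) = Fin k × Fin n  (v_{i,i'} ↦ (i , i'))
  data Terminal (EG : Fin k × Fin n → Fin k × Fin n → Set) :
                V k n L Lp → V k n L Lp → Set where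
    t-p : ∀ i (j : Fin n) → toℕ j ≡ ⌊ n /2⌋ → Terminal EG (pEnd Lp i j) (u i j)
    t-e : ∀ (i j : Fin k) (i' j' : Fin n) → toℕ i < toℕ j →
          EG (i , i') (j , j') → Terminal EG (u' i i') (u' j j')

  -- w satisfies d(x,w) + d(w,y) ≤ (1 + α) d(x,y), with α = p / q
  Serves : (p q : ℕ) → V k n L Lp → V k n L Lp → V k n L Lp → Set
  Serves p q x y w = ∃[ a ] ∃[ c ] ∃[ e ]
    (Dist x w a × Dist w y c × Dist x y e × q * (a + c) ≤ (q + p) * e)

  -- S* is nice: |S* ∩ U_i| = 1 for every i, and S* ⊆ ⋃_i U_i
  -- (U_i = {u_{i,1},…,u_{i,n}}); sets are represented by lists.
  Nice : List (V k n L Lp) → Set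
  Nice S = (∀ i → ∃[ j ] (u i j ∈ S × (∀ j' → u i j' ∈ S → j' ≡ j)))
         × (∀ w → w ∈ S → ∃[ i ] ∃[ j ] (w ≡ u i j))

  Solution : (Fin k × Fin n → Fin k × Fin n → Set) → (p q : ℕ) →
             List (V k n L Lp) → Set
  Solution EG p q S = ∀ x y → Terminal EG x y → ∃[ w ] (w ∈ S × Serves p q x y w)

-- the parameters L = ⌈n/(2α)⌉ and L_p = ⌈(n-1)/α⌉ for α = p / q
Lof : (n p q : ℕ) → ℕ
Lof n p q = ceilDiv (n * q) (2 * p)

Lpof : (n p q : ℕ) → ℕ
Lpof n p q = ceilDiv ((n ∸ 1) * q) p

V' : (k n p q : ℕ) → Set
V' k n p q = V k n (Lof n p q) (Lpof n p q)

{-# OPTIONS --safe #-}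
-- Write n = 2R + 1.  Distances in G′ are certified by potentials that change by at most 1 along
-- every edge: such an f gives d(x, y) ≥ f y − f x, and a walk of exactly that length is shortest.
-- As d(p_i, u_{i,mid}) = L_p and α L_p < n, a vertex serving {p_i, u_{i,mid}} lies within R of
-- u_{i,mid} inside gadget i (on U_i, on a spoke of U_i or on the p_i-path), so it determines a
-- vertex u_{i,c_i}.  These servers differ for different i, hence by |S| ≤ k they are all of S.
-- A server of an edge pair {u′_{i,a}, u′_{j,a′}} cannot lie in a third gadget, as the detour costs
-- at least 4L − 2R > 3L ≥ (1 + α) 2L.  If it lies in gadget i, then u_{i,c_i} serves the pair too:
-- for c_i = a no vertex attached to u_{i,a} does better than u_{i,a} itself, and for c_i ≠ a
-- d(u′_{i,a}, u_{i,c_i}) + 2L ≤ n + 2L ≤ (1 + α) 2L by the choice of L.  So S* = {u_{i,c_i}} works.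
module Submission where

open import Defs
open import Data.Bool using (true; false; if_then_else_)
open import Data.Empty using (⊥; ⊥-elim)
open import Data.Fin using (Fin; toℕ; fromℕ; fromℕ<; zero; suc; punchOut)
open import Data.Fin.Properties
  using (toℕ-injective; toℕ-fromℕ; toℕ-fromℕ<; toℕ<n; _≟_; any?; pigeonhole; punchOut-injective)
  renaming (<⇒≢ to <⇒≢ᶠ)
open import Data.List using (List; []; _∷_; length; lookup; map; allFin)
open import Data.List.Membership.Propositional using (_∈_)
open import Data.List.Membership.Propositional.Properties using (∈-map⁺; ∈-map⁻; ∈-allFin)
open import Data.List.Properties using (length-map; length-tabulate)
open import Data.List.Relation.Unary.Any using (index)
open import Data.List.Relation.Unary.Any.Properties using (lookup-index)
open import Data.Nat hiding (_≟_)
open import Data.Nat.DivMod using (_%_; _/_; m≡m%n+[m/n]*n; m%n<n)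
open import Data.Nat.Properties hiding (_≟_)
open import Data.Nat.Tactic.RingSolver using (solve-∀)
open import Data.Product using (Σ; ∃; _×_; _,_; proj₁; proj₂)
open import Data.Sum using (_⊎_; inj₁; inj₂)
open import Function using (_∘_; id)
open import Relation.Binary.PropositionalEquality
open import Relation.Nullary using (¬_; Dec; yes; no; does)
open import Relation.Nullary.Decidable using (dec-true; dec-false)

Close : ℕ → ℕ → Set
Close x y = x ≤ suc y × y ≤ suc x

close-refl : ∀ {x} → Close x x
close-refl = n≤1+n _ , n≤1+n _

close-sym : ∀ {x y} → Close x y → Close y x
close-sym (x≤1+y , y≤1+x) = y≤1+x , x≤1+y

close-suc : ∀ {x} → Close x (suc x)
close-suc = m≤n⇒m≤1+n (n≤1+n _) , ≤-refl

close-∸1 : ∀ x → Close (x ∸ 1) x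
close-∸1 x = m≤n⇒m≤1+n (m∸n≤m x 1) , m≤n+m∸n x 1

close-+ˡ : ∀ c {x y} → Close x y → Close (c + x) (c + y)
close-+ˡ c {x} {y} (x≤1+y , y≤1+x) =
  ≤-trans (+-monoʳ-≤ c x≤1+y) (≤-reflexive (+-suc c y)) ,
  ≤-trans (+-monoʳ-≤ c y≤1+x) (≤-reflexive (+-suc c x))

∸-≤-suc : ∀ c x y → y ≤ suc x → c ∸ x ≤ suc (c ∸ y)
∸-≤-suc zero    zero    _             _           = z≤n
∸-≤-suc zero    (suc x) _             _           = z≤n
∸-≤-suc (suc c) zero    zero          _           = n≤1+n _
∸-≤-suc (suc c) zero    (suc zero)    _           = ≤-refl
∸-≤-suc (suc c) zero    (suc (suc y)) (s≤s ())
∸-≤-suc (suc c) (suc x) zero          _           = m≤n⇒m≤1+n (m≤n⇒m≤1+n (m∸n≤m c x))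
∸-≤-suc (suc c) (suc x) (suc y)       (s≤s y≤1+x) = ∸-≤-suc c x y y≤1+x

close-∸ˡ : ∀ c {x y} → Close x y → Close (c ∸ x) (c ∸ y)
close-∸ˡ c {x} {y} (x≤1+y , y≤1+x) = ∸-≤-suc c x y y≤1+x , ∸-≤-suc c y x x≤1+y

close-⊓ : ∀ {x x′ y y′} → Close x x′ → Close y y′ → Close (x ⊓ y) (x′ ⊓ y′)
close-⊓ (x≤ , x′≤) (y≤ , y′≤) = ⊓-mono-≤ x≤ y≤ , ⊓-mono-≤ x′≤ y′≤

close-∣suc-∣ : ∀ x c → Close ∣ x - c ∣ ∣ suc x - c ∣
close-∣suc-∣ x       zero    rewrite ∣-∣-identityʳ x = close-suc
close-∣suc-∣ zero    (suc c) = close-sym close-suc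
close-∣suc-∣ (suc x) (suc c) = close-∣suc-∣ x c

close-∣-suc∣ : ∀ c x → Close ∣ c - x ∣ ∣ c - suc x ∣
close-∣-suc∣ c x rewrite ∣-∣-comm c x | ∣-∣-comm c (suc x) = close-∣suc-∣ x c

module _ {k n L Lp : ℕ} where

  private
    Vertex : Set
    Vertex = V k n L Lp

  Adj-sym : ∀ {x y : Vertex} → Adj x y → Adj y x
  Adj-sym (inj₁ e) = inj₂ e
  Adj-sym (inj₂ e) = inj₁ e

  _++ʷ_ : ∀ {x y z : Vertex} {m m′} → Walk x y m → Walk y z m′ → Walk x z (m + m′)
  []      ++ʷ w′ = w′
  (a ∷ w) ++ʷ w′ = a ∷ (w ++ʷ w′)

  reverseʷ : ∀ {x y : Vertex} {m} → Walk x y m → Walk y x m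
  reverseʷ {m = m} w = subst (Walk _ _) (+-identityʳ m) (reverse-onto w [])
    where
    reverse-onto : ∀ {x y z : Vertex} {m m′} → Walk x y m → Walk x z m′ → Walk y z (m + m′)
    reverse-onto []                       acc = acc
    reverse-onto {m = suc m} {m′} (a ∷ w) acc =
      subst (Walk _ _) (+-suc m m′) (reverse-onto w (Adj-sym a ∷ acc))

  Dist-sym : ∀ {x y : Vertex} {m} → Dist x y m → Dist y x m
  Dist-sym (w , shortest) = reverseʷ w , λ m′ w′ → shortest m′ (reverseʷ w′)

  Dist-minimal : ∀ {x y : Vertex} {m m′} → Dist x y m → Walk x y m′ → m ≤ m′
  Dist-minimal (_ , shortest) w = shortest _ w

  Serves-sym : ∀ {p q} {x y w : Vertex} → Serves p q x y w → Serves p q y x w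
  Serves-sym {p = p} {q = q} (a , c , e , x~w , w~y , x~y , stretch) =
    c , a , e , Dist-sym w~y , Dist-sym x~w , Dist-sym x~y ,
    subst (λ s → q * s ≤ (q + p) * e) (+-comm a c) stretch

  Lipschitz : (Vertex → ℕ) → Set
  Lipschitz f = ∀ {x y} → E x y → Close (f x) (f y)

  module _ {f : Vertex → ℕ} (lip : Lipschitz f) where

    lipschitz-walk : ∀ {x y m} → Walk x y m → f x ≤ m + f y
    lipschitz-walk []            = ≤-refl
    lipschitz-walk (inj₁ e ∷ w) = ≤-trans (proj₁ (lip e)) (s≤s (lipschitz-walk w))
    lipschitz-walk (inj₂ e ∷ w) = ≤-trans (proj₂ (lip e)) (s≤s (lipschitz-walk w))

    walk-length-≥ : ∀ {x y m} → Walk x y m → f y ≡ 0 → f x ≤ m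
    walk-length-≥ {x} {m = m} w fy≡0 =
      subst (f x ≤_) (trans (cong (m +_) fy≡0) (+-identityʳ m)) (lipschitz-walk w)

    walk-length-≥ʳ : ∀ {x y m} → Walk x y m → f x ≡ 0 → f y ≤ m
    walk-length-≥ʳ w = walk-length-≥ (reverseʷ w)

    shortest-from : ∀ {x y m} → Walk x y m → f x ≡ 0 → m ≤ f y → Dist x y m
    shortest-from w fx≡0 m≤fy = w , λ _ w′ → ≤-trans m≤fy (walk-length-≥ʳ w′ fx≡0)

    shortest-to : ∀ {x y m} → Walk x y m → f y ≡ 0 → m ≤ f x → Dist x y m
    shortest-to w fy≡0 m≤fx = w , λ _ w′ → ≤-trans m≤fx (walk-length-≥ w′ fy≡0)

  IsPath : ∀ {m} → (Fin m → Vertex) → Set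
  IsPath {m} g = ∀ (t t′ : Fin m) → suc (toℕ t) ≡ toℕ t′ → Adj (g t) (g t′)

  walk-along : ∀ {m} (g : Fin m → Vertex) → IsPath g →
               ∀ d (s t : Fin m) → toℕ s + d ≡ toℕ t → Walk (g s) (g t) d
  walk-along g path zero s t s+0≡t =
    subst (λ t → Walk (g s) (g t) 0) (toℕ-injective (trans (sym (+-identityʳ _)) s+0≡t)) []
  walk-along {m} g path (suc d) s t s+1+d≡t =
    path s s′ (sym (toℕ-fromℕ< s′<m)) ∷ walk-along g path d s′ t s′+d≡t
    where
    s+1+d≡t′ : suc (toℕ s) + d ≡ toℕ t
    s+1+d≡t′ = trans (sym (+-suc (toℕ s) d)) s+1+d≡t
    s′<m : suc (toℕ s) < m
    s′<m = ≤-<-trans (≤-trans (m≤m+n _ d) (≤-reflexive s+1+d≡t′)) (toℕ<n t)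
    s′ : Fin m
    s′ = fromℕ< s′<m
    s′+d≡t : toℕ s′ + d ≡ toℕ t
    s′+d≡t = trans (cong (_+ d) (toℕ-fromℕ< s′<m)) s+1+d≡t′

  walk-along-∣-∣ : ∀ {m} (g : Fin m → Vertex) → IsPath g →
                   ∀ (s t : Fin m) → Walk (g s) (g t) ∣ toℕ s - toℕ t ∣
  walk-along-∣-∣ g path s t with ≤-total (toℕ s) (toℕ t)
  ... | inj₁ s≤t = subst (Walk _ _) (sym (m≤n⇒∣m-n∣≡n∸m s≤t))
                     (walk-along g path _ s t (m+[n∸m]≡n s≤t))
  ... | inj₂ t≤s = subst (Walk _ _) (sym (m≤n⇒∣n-m∣≡n∸m t≤s))
                     (reverseʷ (walk-along g path _ t s (m+[n∸m]≡n t≤s)))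

  u-walk : ∀ i (s t : Fin n) → Walk (u i s) (u i t) ∣ toℕ s - toℕ t ∣
  u-walk i = walk-along-∣-∣ (u i) (λ t t′ eq → inj₁ (e-u i t t′ eq))

  u′-walk : ∀ i (s t : Fin n) → Walk (u' i s) (u' i t) ∣ toℕ s - toℕ t ∣
  u′-walk i = walk-along-∣-∣ (u' i) (λ t t′ eq → inj₁ (e-u' i t t′ eq))

p-walk : ∀ {k n L} Lp i (j : Fin n) → toℕ j ≡ ⌊ n /2⌋ → Walk {k} {n} {L} {Lp} (pEnd Lp i j) (u i j) Lp
p-walk zero    i j _     = []
p-walk (suc m) i j j-mid = subst (Walk _ _) (+-comm m 1)
  (reverseʷ (walk-along (pin i) (λ t t′ eq → inj₁ (e-p i t t′ eq)) m zero (fromℕ m) (sym (toℕ-fromℕ m)))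
   ++ʷ (inj₂ (e-p₀ i j zero j-mid refl) ∷ []))

spoke-walk : ∀ {k n Lp} L (x : V k n L Lp) (g : Fin (L ∸ 1) → V k n L Lp) → 1 ≤ L →
  (∀ t → toℕ t ≡ 0 → Adj x (g t)) → IsPath g → (∀ t → suc (toℕ t) ≡ L ∸ 1 → Adj (g t) b) →
  (L ≡ 1 → Adj x b) → Walk x b L
spoke-walk (suc zero)    x g _ _     _    _    x~b = x~b refl ∷ []
spoke-walk (suc (suc m)) x g _ x~g₀ path g~b _   = subst (Walk x b) (cong suc (+-comm m 1))
  (x~g₀ zero refl ∷ (walk-along g path m zero (fromℕ m) (sym (toℕ-fromℕ m))
                     ++ʷ (g~b (fromℕ m) (cong suc (toℕ-fromℕ m)) ∷ [])))

u-spoke : ∀ {k n Lp} L → 1 ≤ L → ∀ i j → Walk {k} {n} {L} {Lp} (u i j) b L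
u-spoke L 1≤L i j = spoke-walk L (u i j) (su i j) 1≤L
  (λ t eq → inj₁ (e-s₀ i j t eq)) (λ t t′ eq → inj₁ (e-s i j t t′ eq))
  (λ t eq → inj₁ (e-sb i j t eq)) (λ eq → inj₁ (e-ub i j eq))

u′-spoke : ∀ {k n Lp} L → 1 ≤ L → ∀ i j → Walk {k} {n} {L} {Lp} (u' i j) b L
u′-spoke L 1≤L i j = spoke-walk L (u' i j) (su' i j) 1≤L
  (λ t eq → inj₁ (e-s'₀ i j t eq)) (λ t t′ eq → inj₁ (e-s' i j t t′ eq))
  (λ t eq → inj₁ (e-s'b i j t eq)) (λ eq → inj₁ (e-u'b i j eq))

pEnd-cases : ∀ {k n L} Lp i (j : Fin n) →
  (pEnd {k} {n} {L} Lp i j ≡ u i j × Lp ≡ 0) ⊎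
  (∃ λ t → pEnd {k} {n} {L} Lp i j ≡ pin i t × suc (toℕ t) ≡ Lp)
pEnd-cases zero    i j = inj₁ (refl , refl)
pEnd-cases (suc m) i j = inj₂ (fromℕ m , refl , cong suc (toℕ-fromℕ m))

m≤n*ceilDiv[m,n] : ∀ m d → 0 < d → m ≤ d * ceilDiv m d
m≤n*ceilDiv[m,n] m (suc e) _ = +-cancelʳ-≤ e m _ (begin
  m + e                                  ≡⟨ m≡m%n+[m/n]*n (m + e) (suc e) ⟩
  (m + e) % suc e + (m + e) / suc e * suc e ≤⟨ +-monoˡ-≤ _ (≤-pred (m%n<n (m + e) (suc e))) ⟩
  e + (m + e) / suc e * suc e            ≡⟨ +-comm e _ ⟩
  (m + e) / suc e * suc e + e            ≡⟨ cong (_+ e) (*-comm ((m + e) / suc e) (suc e)) ⟩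
  suc e * ((m + e) / suc e) + e          ∎)
  where open ≤-Reasoning

n*ceilDiv[m,n]<m+n : ∀ m d → 0 < d → d * ceilDiv m d < m + d
n*ceilDiv[m,n]<m+n m (suc e) _ = begin-strict
  suc e * ((m + e) / suc e)                 ≡⟨ *-comm (suc e) _ ⟩
  (m + e) / suc e * suc e                   ≤⟨ m≤n+m _ _ ⟩
  (m + e) % suc e + (m + e) / suc e * suc e ≡⟨ m≡m%n+[m/n]*n (m + e) (suc e) ⟨
  m + e                                     <⟨ +-monoʳ-< m (n<1+n e) ⟩
  m + suc e                                 ∎
  where open ≤-Reasoning

module _ {p q : ℕ} (p>0 : 0 < p) where
  open ≤-Reasoning

  q*n≤2p*Lof : ∀ n → q * n ≤ 2 * p * Lof n p q
  q*n≤2p*Lof n = subst (_≤ 2 * p * Lof n p q) (*-comm n q)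
    (m≤n*ceilDiv[m,n] (n * q) (2 * p) (≤-trans p>0 (m≤m+n p _)))

  n≤Lof : ∀ n → 2 * p ≤ q → n ≤ Lof n p q
  n≤Lof n 2p≤q = *-cancelˡ-≤ (2 * p) {{>-nonZero (≤-trans p>0 (m≤m+n p _))}}
    (≤-trans (*-monoˡ-≤ n 2p≤q) (q*n≤2p*Lof n))

  q*[n∸1]≤p*Lpof : ∀ n → q * (n ∸ 1) ≤ p * Lpof n p q
  q*[n∸1]≤p*Lpof n = subst (_≤ p * Lpof n p q) (*-comm (n ∸ 1) q) (m≤n*ceilDiv[m,n] ((n ∸ 1) * q) p p>0)

  p*Lpof<q*n : ∀ m → p ≤ q → p * Lpof (suc m) p q < q * suc m
  p*Lpof<q*n m p≤q = begin-strict
    p * Lpof (suc m) p q <⟨ n*ceilDiv[m,n]<m+n (m * q) p p>0 ⟩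
    m * q + p            ≤⟨ +-monoʳ-≤ (m * q) p≤q ⟩
    m * q + q            ≡⟨ +-comm (m * q) q ⟩
    q + m * q            ≡⟨ cong (q +_) (*-comm m q) ⟩
    q + q * m            ≡⟨ *-suc q m ⟨
    q * suc m            ∎

odd-form : ∀ n → n % 2 ≡ 1 → ∃ λ R → n ≡ suc (R + R)
odd-form n n%2≡1 = n / 2 , (begin
  n                   ≡⟨ m≡m%n+[m/n]*n n 2 ⟩
  n % 2 + n / 2 * 2   ≡⟨ cong₂ _+_ n%2≡1 (*-comm (n / 2) 2) ⟩
  1 + 2 * (n / 2)     ≡⟨ cong (λ h → suc (n / 2 + h)) (+-identityʳ (n / 2)) ⟩
  suc (n / 2 + n / 2) ∎)
  where open ≡-Reasoning

⌊1+n+n/2⌋≡n : ∀ r → ⌊ suc (r + r) /2⌋ ≡ r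
⌊1+n+n/2⌋≡n zero    = refl
⌊1+n+n/2⌋≡n (suc r) rewrite +-suc r r = cong suc (⌊1+n+n/2⌋≡n r)

m+m<1+n+n⇒m≤n : ∀ m n → m + m < suc (n + n) → m ≤ n
m+m<1+n+n⇒m≤n zero    n       _         = z≤n
m+m<1+n+n⇒m≤n (suc m) zero    (s≤s ())
m+m<1+n+n⇒m≤n (suc m) (suc n) (s≤s lt) rewrite +-suc m m | +-suc n n =
  s≤s (m+m<1+n+n⇒m≤n m n (≤-pred lt))

m⊓1+n≤n⇒m≤n : ∀ m n → m ⊓ suc n ≤ n → m ≤ n
m⊓1+n≤n⇒m≤n zero    n       _         = z≤n
m⊓1+n≤n⇒m≤n (suc m) zero    ()
m⊓1+n≤n⇒m≤n (suc m) (suc n) (s≤s le) = s≤s (m⊓1+n≤n⇒m≤n m n le)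

m∸[m∸n]≤n : ∀ m n → m ∸ (m ∸ n) ≤ n
m∸[m∸n]≤n m n with ≤-total n m
... | inj₁ n≤m = ≤-reflexive (m∸[m∸n]≡n n≤m)
... | inj₂ m≤n rewrite m≤n⇒m∸n≡0 m≤n = m≤n

-- q * (a + c) ≤ (q + p) * e  is  a + c ≤ (1 + α) e  for α = p / q.
module _ {p q : ℕ} where
  open ≤-Reasoning

  stretch-at-middle : ∀ {Lp R D a c e} → Lp + D ≤ a → D ≤ c → e ≤ Lp →
                      q * (a + c) ≤ (q + p) * e → p * Lp < q * suc (R + R) → D ≤ R
  stretch-at-middle {Lp} {R} {D} {a} {c} {e} Lp+D≤a D≤c e≤Lp stretch pLp<qn =
    m+m<1+n+n⇒m≤n D R (*-cancelˡ-< q (D + D) (suc (R + R)) (≤-<-trans q[D+D]≤pLp pLp<qn))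
    where
    q[D+D]≤pLp : q * (D + D) ≤ p * Lp
    q[D+D]≤pLp = +-cancelˡ-≤ (q * Lp) _ _ (begin
      q * Lp + q * (D + D) ≡⟨ *-distribˡ-+ q Lp (D + D) ⟨
      q * (Lp + (D + D))   ≡⟨ cong (q *_) (+-assoc Lp D D) ⟨
      q * (Lp + D + D)     ≤⟨ *-monoʳ-≤ q (+-mono-≤ Lp+D≤a D≤c) ⟩
      q * (a + c)          ≤⟨ stretch ⟩
      (q + p) * e          ≤⟨ *-monoʳ-≤ (q + p) e≤Lp ⟩
      (q + p) * Lp         ≡⟨ *-distribʳ-+ Lp q p ⟩
      q * Lp + p * Lp      ∎)

  stretch-to-middle : ∀ {Lp R X e} → X ≤ R → Lp ≤ e → q * (R + R) ≤ p * Lp →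
                      q * ((Lp + X) + X) ≤ (q + p) * e
  stretch-to-middle {Lp} {R} {X} {e} X≤R Lp≤e q[R+R]≤pLp = begin
    q * ((Lp + X) + X)   ≡⟨ cong (q *_) (+-assoc Lp X X) ⟩
    q * (Lp + (X + X))   ≤⟨ *-monoʳ-≤ q (+-monoʳ-≤ Lp (+-mono-≤ X≤R X≤R)) ⟩
    q * (Lp + (R + R))   ≡⟨ *-distribˡ-+ q Lp (R + R) ⟩
    q * Lp + q * (R + R) ≤⟨ +-monoʳ-≤ (q * Lp) q[R+R]≤pLp ⟩
    q * Lp + p * Lp      ≡⟨ *-distribʳ-+ Lp q p ⟨
    (q + p) * Lp         ≤⟨ *-monoʳ-≤ (q + p) Lp≤e ⟩
    (q + p) * e          ∎

  stretch-across : ∀ {L n m e} → m ≤ n → L + L ≤ e → q * n ≤ 2 * p * L →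
                   q * (m + (L + L)) ≤ (q + p) * e
  stretch-across {L} {n} {m} {e} m≤n 2L≤e qn≤2pL = begin
    q * (m + (L + L))       ≤⟨ *-monoʳ-≤ q (+-monoˡ-≤ (L + L) m≤n) ⟩
    q * (n + (L + L))       ≡⟨ *-distribˡ-+ q n (L + L) ⟩
    q * n + q * (L + L)     ≤⟨ +-monoˡ-≤ (q * (L + L)) qn≤2pL ⟩
    2 * p * L + q * (L + L) ≡⟨ regroup q p L ⟩
    (q + p) * (L + L)       ≤⟨ *-monoʳ-≤ (q + p) 2L≤e ⟩
    (q + p) * e             ∎
    where
    regroup : ∀ q p L → 2 * p * L + q * (L + L) ≡ (q + p) * (L + L)
    regroup = solve-∀

  stretch-no-detour : ∀ {L R a c e x y} → 0 < q → 2 * p ≤ q → suc (R + R) ≤ L →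
                      L + L ≤ a + x → L + L ≤ c + y → x ≤ R → y ≤ R → e ≤ L + L →
                      q * (a + c) ≤ (q + p) * e → ⊥
  stretch-no-detour {L} {R} {a} {c} {e} {x} {y} q>0 2p≤q n≤L 2L≤a+x 2L≤c+y x≤R y≤R e≤2L stretch =
    <⇒≱ n≤L (*-cancelˡ-≤ q {{>-nonZero q>0}} (+-cancelˡ-≤ (q * L + q * L + q * L) _ _ 4qL≤3qL+2qR))
    where
    4L≤a+c+2R : (L + L) + (L + L) ≤ (a + c) + (R + R)
    4L≤a+c+2R = begin
      (L + L) + (L + L) ≤⟨ +-mono-≤ 2L≤a+x 2L≤c+y ⟩
      (a + x) + (c + y) ≡⟨ interchange a x c y ⟩
      (a + c) + (x + y) ≤⟨ +-monoʳ-≤ (a + c) (+-mono-≤ x≤R y≤R) ⟩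
      (a + c) + (R + R) ∎
      where
      interchange : ∀ a x c y → (a + x) + (c + y) ≡ (a + c) + (x + y)
      interchange = solve-∀
    4qL≤3qL+2qR : q * L + q * L + q * L + q * L ≤ q * L + q * L + q * L + q * (R + R)
    4qL≤3qL+2qR = begin
      q * L + q * L + q * L + q * L             ≡⟨ four q L ⟩
      q * ((L + L) + (L + L))                   ≤⟨ *-monoʳ-≤ q 4L≤a+c+2R ⟩
      q * ((a + c) + (R + R))                   ≡⟨ *-distribˡ-+ q (a + c) (R + R) ⟩
      q * (a + c) + q * (R + R)
        ≤⟨ +-monoˡ-≤ _ (≤-trans stretch (*-monoʳ-≤ (q + p) e≤2L)) ⟩
      (q + p) * (L + L) + q * (R + R)
        ≡⟨ expand q p L R ⟩
      q * L + q * L + 2 * p * L + q * (R + R)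
        ≤⟨ +-monoˡ-≤ (q * (R + R)) (+-monoʳ-≤ (q * L + q * L) (*-monoˡ-≤ L 2p≤q)) ⟩
      q * L + q * L + q * L + q * (R + R)       ∎
      where
      four : ∀ q L → q * L + q * L + q * L + q * L ≡ q * ((L + L) + (L + L))
      four = solve-∀
      expand : ∀ q p L R → (q + p) * (L + L) + q * (R + R) ≡ q * L + q * L + 2 * p * L + q * (R + R)
      expand = solve-∀

module _ {a c M : ℕ} where
  open ≡-Reasoning

  via-z-length : a ≤ c → c ≤ M → a + suc (suc (M ∸ c)) ≤ suc (suc M) ∸ (c ∸ a)
  via-z-length a≤c c≤M = m+n≤o⇒m≤o∸n _ (≤-reflexive (begin
    a + suc (suc (M ∸ c)) + (c ∸ a)     ≡⟨ regroup a (M ∸ c) (c ∸ a) ⟩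
    suc (suc ((M ∸ c) + ((c ∸ a) + a))) ≡⟨ cong (λ h → suc (suc ((M ∸ c) + h))) (m∸n+n≡m a≤c) ⟩
    suc (suc ((M ∸ c) + c))             ≡⟨ cong (λ h → suc (suc h)) (m∸n+n≡m c≤M) ⟩
    suc (suc M)                         ∎))
    where
    regroup : ∀ a x y → a + suc (suc x) + y ≡ suc (suc (x + (y + a)))
    regroup = solve-∀

  via-z′-length : c ≤ a → a ≤ M → (M ∸ a) + suc (suc c) ≤ suc (suc M) ∸ (a ∸ c)
  via-z′-length c≤a a≤M = m+n≤o⇒m≤o∸n _ (≤-reflexive (begin
    (M ∸ a) + suc (suc c) + (a ∸ c)     ≡⟨ regroup (M ∸ a) c (a ∸ c) ⟩
    suc (suc ((M ∸ a) + ((a ∸ c) + c))) ≡⟨ cong (λ h → suc (suc ((M ∸ a) + h))) (m∸n+n≡m c≤a) ⟩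
    suc (suc ((M ∸ a) + a))             ≡⟨ cong (λ h → suc (suc h)) (m∸n+n≡m a≤M) ⟩
    suc (suc M)                         ∎))
    where
    regroup : ∀ x c y → x + suc (suc c) + y ≡ suc (suc (x + (y + c)))
    regroup = solve-∀

-- If w were none of the f l, punching its position out of S would inject Fin k into fewer than k
-- positions.
short-list-⊆-injective-image : ∀ {A : Set} (S : List A) {k} (f : Fin k → A) → (∀ i → f i ∈ S) →
                               (∀ i j → f i ≡ f j → i ≡ j) → length S ≤ k →
                               ∀ {w} → w ∈ S → ∃ λ l → w ≡ f l
short-list-⊆-injective-image []         f f∈S f-inj |S|≤k ()
short-list-⊆-injective-image S@(_ ∷ S′) {k} f f∈S f-inj |S|≤k {w} w∈S
  with any? (λ l → index (f∈S l) ≟ index w∈S)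
... | yes (l , same) = l , trans (lookup-index w∈S)
                             (trans (cong (lookup S) (sym same)) (sym (lookup-index (f∈S l))))
... | no missed with pigeonhole |S|≤k squeeze
  where
  squeeze : Fin k → Fin (length S′)
  squeeze l = punchOut {i = index w∈S} {j = index (f∈S l)} (λ eq → missed (l , sym eq))
... | l₁ , l₂ , l₁<l₂ , squeeze-eq = ⊥-elim (<⇒≢ᶠ l₁<l₂ (f-inj l₁ l₂ fl₁≡fl₂))
  where
  same-index : index (f∈S l₁) ≡ index (f∈S l₂)
  same-index = punchOut-injective {i = index w∈S}
    (λ eq → missed (l₁ , sym eq)) (λ eq → missed (l₂ , sym eq)) squeeze-eq
  fl₁≡fl₂ : f l₁ ≡ f l₂
  fl₁≡fl₂ = trans (lookup-index (f∈S l₁))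
              (trans (cong (lookup S) same-index) (sym (lookup-index (f∈S l₂))))

ifSame : ∀ {k} → Fin k → Fin k → ℕ → ℕ → ℕ
ifSame i₀ i x y = if does (i₀ ≟ i) then x else y

module _ {k : ℕ} where

  ifSame-refl : ∀ (i : Fin k) {x y} → ifSame i i x y ≡ x
  ifSame-refl i {x} {y} = cong (λ c → if c then x else y) (dec-true (i ≟ i) refl)

  ifSame-≢ : ∀ {i₀ i : Fin k} {x y} → i₀ ≢ i → ifSame i₀ i x y ≡ y
  ifSame-≢ {i₀} {i} {x} {y} i₀≢i = cong (λ c → if c then x else y) (dec-false (i₀ ≟ i) i₀≢i)

  close-ifSame : ∀ (i₀ i : Fin k) {x x′ y y′} → Close x x′ → Close y y′ →
                 Close (ifSame i₀ i x y) (ifSame i₀ i x′ y′)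
  close-ifSame i₀ i = close-if (does (i₀ ≟ i))
    where
    close-if : ∀ c {x x′ y y′} → Close x x′ → Close y y′ →
               Close (if c then x else y) (if c then x′ else y′)
    close-if true  x~x′ _    = x~x′
    close-if false _    y~y′ = y~y′

  close-ifSame-const : ∀ (i₀ i : Fin k) {x y z} → Close x z → Close y z → Close (ifSame i₀ i x y) z
  close-ifSame-const i₀ i = close-if (does (i₀ ≟ i))
    where
    close-if : ∀ c {x y z} → Close x z → Close y z → Close (if c then x else y) z
    close-if true  x~z _   = x~z
    close-if false _   y~z = y~z

module Gadget (k R L Lp : ℕ) (n≤L : suc (R + R) ≤ L) where

  n : ℕ
  n = suc (R + R)

  private
    Vertex : Set
    Vertex = V k n L Lp

  1≤L : 1 ≤ L
  1≤L = ≤-trans (s≤s z≤n) n≤L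

  R≤L∸1 : R ≤ L ∸ 1
  R≤L∸1 = ≤-trans (m≤m+n R R) (∸-monoˡ-≤ 1 n≤L)

  L≡1⇒R≡0 : L ≡ 1 → R ≡ 0
  L≡1⇒R≡0 L≡1 = n≤0⇒n≡0 (≤-trans (m≤m+n R R) (≤-pred (subst (n ≤_) L≡1 n≤L)))

  n+1≤L+L : suc n ≤ L + L
  n+1≤L+L = ≤-trans (≤-reflexive (+-comm 1 n)) (+-mono-≤ n≤L 1≤L)

  toℕ≤2R : (j : Fin n) → toℕ j ≤ R + R
  toℕ≤2R j = ≤-pred (toℕ<n j)

  ∣j-R∣≤R : (j : Fin n) → ∣ toℕ j - R ∣ ≤ R
  ∣j-R∣≤R j with ≤-total (toℕ j) R
  ... | inj₁ j≤R = subst (_≤ R) (sym (m≤n⇒∣m-n∣≡n∸m j≤R)) (m∸n≤m R (toℕ j))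
  ... | inj₂ R≤j = subst (_≤ R) (sym (m≤n⇒∣n-m∣≡n∸m R≤j))
                     (≤-trans (∸-monoˡ-≤ R (toℕ≤2R j)) (≤-reflexive (m+n∸n≡m R R)))

  ∣a-j∣≤2R : ∀ a (j : Fin n) → a ≤ R + R → ∣ a - toℕ j ∣ ≤ R + R
  ∣a-j∣≤2R a j a≤2R = ≤-trans (∣m-n∣≤m⊔n a (toℕ j)) (⊔-lub a≤2R (toℕ≤2R j))

  mid : Fin n
  mid = fromℕ< {R} (s≤s (m≤m+n R R))

  toℕ-mid : toℕ mid ≡ R
  toℕ-mid = toℕ-fromℕ< (s≤s (m≤m+n R R))

  mid-is-middle : toℕ mid ≡ ⌊ n /2⌋
  mid-is-middle = trans toℕ-mid (sym (⌊1+n+n/2⌋≡n R))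

  middle⇒≡mid : ∀ {j : Fin n} → toℕ j ≡ ⌊ n /2⌋ → j ≡ mid
  middle⇒≡mid j-mid = toℕ-injective (trans j-mid (sym mid-is-middle))

  -- A lower bound for the distance to u_{i₀,mid}, truncated at R + 1; it vanishes on the p-path.
  toMid : Fin k → Vertex → ℕ
  toMid i₀ (u i j)    = ifSame i₀ i ∣ toℕ j - R ∣ (suc R)
  toMid i₀ (pin i t)  = ifSame i₀ i 0 (suc R)
  toMid i₀ (su i j t) = ifSame i₀ i ((∣ toℕ j - R ∣ + suc (toℕ t)) ⊓ suc R) (suc R)
  toMid i₀ _          = suc R

  toMid-lipschitz : ∀ i₀ → Lipschitz (toMid i₀)
  toMid-lipschitz i₀ (e-u i j j′ eq) rewrite sym eq =
    close-ifSame i₀ i (close-∣suc-∣ (toℕ j) R) close-refl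
  toMid-lipschitz i₀ (e-z₂ i j eq)
    rewrite suc-injective eq | m≤n⇒∣n-m∣≡n∸m (m≤m+n R R) | m+n∸m≡n R R =
    close-sym (close-ifSame-const i₀ i close-suc close-refl)
  toMid-lipschitz i₀ (e-z'₂ i j eq) rewrite eq =
    close-sym (close-ifSame-const i₀ i close-suc close-refl)
  toMid-lipschitz i₀ (e-p₀ i j t j-mid _) rewrite j-mid | ⌊1+n+n/2⌋≡n R | ∣n-n∣≡0 R =
    close-ifSame i₀ i close-refl close-refl
  toMid-lipschitz i₀ (e-p i t t′ _)  = close-ifSame i₀ i close-refl close-refl
  toMid-lipschitz i₀ (e-s₀ i j t t≡0) rewrite t≡0 | +-comm ∣ toℕ j - R ∣ 1
    | m≤n⇒m⊓n≡m (s≤s (∣j-R∣≤R j)) = close-ifSame i₀ i close-suc close-refl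
  toMid-lipschitz i₀ (e-s i j t t′ eq) rewrite sym eq =
    close-ifSame i₀ i (close-⊓ (close-+ˡ ∣ toℕ j - R ∣ close-suc) close-refl) close-refl
  toMid-lipschitz i₀ (e-sb i j t eq) = close-ifSame-const i₀ i
    (m≤n⇒m≤1+n (m⊓n≤n _ (suc R)) ,
     s≤s (⊓-glb (≤-trans R≤L∸1 (≤-trans (≤-reflexive (sym eq)) (m≤n+m _ _))) (n≤1+n R)))
    close-refl
  toMid-lipschitz i₀ (e-ub i j L≡1) = close-ifSame-const i₀ i
    (m≤n⇒m≤1+n (m≤n⇒m≤1+n (∣j-R∣≤R j)) , s≤s (subst (_≤ ∣ toℕ j - R ∣) (sym (L≡1⇒R≡0 L≡1)) z≤n))
    close-refl
  toMid-lipschitz i₀ (e-u' _ _ _ _)    = close-refl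
  toMid-lipschitz i₀ (e-z₁ _ _ _)      = close-refl
  toMid-lipschitz i₀ (e-z'₁ _ _ _)     = close-refl
  toMid-lipschitz i₀ (e-s'₀ _ _ _ _)   = close-refl
  toMid-lipschitz i₀ (e-s' _ _ _ _ _)  = close-refl
  toMid-lipschitz i₀ (e-s'b _ _ _ _)   = close-refl
  toMid-lipschitz i₀ (e-u'b _ _ _)     = close-refl

  fromP : Fin k → Vertex → ℕ
  fromP i₀ (pin i t) = ifSame i₀ i (Lp ∸ suc (toℕ t)) (Lp + suc R)
  fromP i₀ v         = Lp + toMid i₀ v

  fromP-lipschitz : ∀ i₀ → Lipschitz (fromP i₀)
  fromP-lipschitz i₀ (e-p₀ i j t j-mid t≡0) with i₀ ≟ i
  ... | yes _ rewrite j-mid | ⌊1+n+n/2⌋≡n R | ∣n-n∣≡0 R | +-identityʳ Lp | t≡0 =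
    close-sym (close-∸1 Lp)
  ... | no _  = close-refl
  fromP-lipschitz i₀ (e-p i t t′ eq) rewrite sym eq = close-ifSame i₀ i (close-∸ˡ Lp close-suc) close-refl
  fromP-lipschitz i₀ e@(e-u' _ _ _ _)   = close-+ˡ Lp (toMid-lipschitz i₀ e)
  fromP-lipschitz i₀ e@(e-u _ _ _ _)    = close-+ˡ Lp (toMid-lipschitz i₀ e)
  fromP-lipschitz i₀ e@(e-z₁ _ _ _)     = close-+ˡ Lp (toMid-lipschitz i₀ e)
  fromP-lipschitz i₀ e@(e-z₂ _ _ _)     = close-+ˡ Lp (toMid-lipschitz i₀ e)
  fromP-lipschitz i₀ e@(e-z'₁ _ _ _)    = close-+ˡ Lp (toMid-lipschitz i₀ e)
  fromP-lipschitz i₀ e@(e-z'₂ _ _ _)    = close-+ˡ Lp (toMid-lipschitz i₀ e)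
  fromP-lipschitz i₀ e@(e-s₀ _ _ _ _)   = close-+ˡ Lp (toMid-lipschitz i₀ e)
  fromP-lipschitz i₀ e@(e-s _ _ _ _ _)  = close-+ˡ Lp (toMid-lipschitz i₀ e)
  fromP-lipschitz i₀ e@(e-sb _ _ _ _)   = close-+ˡ Lp (toMid-lipschitz i₀ e)
  fromP-lipschitz i₀ e@(e-ub _ _ _)     = close-+ˡ Lp (toMid-lipschitz i₀ e)
  fromP-lipschitz i₀ e@(e-s'₀ _ _ _ _)  = close-+ˡ Lp (toMid-lipschitz i₀ e)
  fromP-lipschitz i₀ e@(e-s' _ _ _ _ _) = close-+ˡ Lp (toMid-lipschitz i₀ e)
  fromP-lipschitz i₀ e@(e-s'b _ _ _ _)  = close-+ˡ Lp (toMid-lipschitz i₀ e)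
  fromP-lipschitz i₀ e@(e-u'b _ _ _)    = close-+ˡ Lp (toMid-lipschitz i₀ e)

  L∸[1+t]≡1 : ∀ {t} → suc t ≡ L ∸ 1 → L ∸ suc t ≡ 1
  L∸[1+t]≡1 eq rewrite eq = m∸[m∸n]≡n 1≤L

  -- depth i₀ is L plus the signed distance to b: positive in gadget i₀, negative (truncated at 0)
  -- in the other gadgets.
  signed : Fin k → Fin k → ℕ → ℕ
  signed i₀ i h = ifSame i₀ i (L + h) (L ∸ h)

  close-signed : ∀ i₀ i {h h′} → Close h h′ → Close (signed i₀ i h) (signed i₀ i h′)
  close-signed i₀ i h~h′ = close-ifSame i₀ i (close-+ˡ L h~h′) (close-∸ˡ L h~h′)

  close-signed-b : ∀ i₀ i {h} → h ≡ 1 → Close (signed i₀ i h) L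
  close-signed-b i₀ i refl = close-ifSame-const i₀ i
    (subst (λ x → Close x L) (+-comm 1 L) (close-sym close-suc)) (close-∸1 L)

  depth : Fin k → Vertex → ℕ
  depth i₀ b           = L
  depth i₀ (u i _)     = signed i₀ i L
  depth i₀ (u' i _)    = signed i₀ i L
  depth i₀ (z i)       = signed i₀ i L
  depth i₀ (z' i)      = signed i₀ i L
  depth i₀ (pin i t)   = signed i₀ i (L + suc (toℕ t))
  depth i₀ (su i _ t)  = signed i₀ i (L ∸ suc (toℕ t))
  depth i₀ (su' i _ t) = signed i₀ i (L ∸ suc (toℕ t))

  depth-lipschitz : ∀ i₀ → Lipschitz (depth i₀)
  depth-lipschitz i₀ (e-u' i _ _ _)   = close-signed i₀ i close-refl
  depth-lipschitz i₀ (e-u i _ _ _)    = close-signed i₀ i close-refl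
  depth-lipschitz i₀ (e-z₁ i _ _)     = close-signed i₀ i close-refl
  depth-lipschitz i₀ (e-z₂ i _ _)     = close-signed i₀ i close-refl
  depth-lipschitz i₀ (e-z'₁ i _ _)    = close-signed i₀ i close-refl
  depth-lipschitz i₀ (e-z'₂ i _ _)    = close-signed i₀ i close-refl
  depth-lipschitz i₀ (e-p₀ i _ t _ t≡0) rewrite t≡0 | +-comm L 1 = close-signed i₀ i close-suc
  depth-lipschitz i₀ (e-p i t t′ eq) rewrite sym eq = close-signed i₀ i (close-+ˡ L close-suc)
  depth-lipschitz i₀ (e-s₀ i _ t t≡0) rewrite t≡0 = close-signed i₀ i (close-sym (close-∸1 L))
  depth-lipschitz i₀ (e-s i _ t t′ eq) rewrite sym eq = close-signed i₀ i (close-∸ˡ L close-suc)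
  depth-lipschitz i₀ (e-sb i _ t eq)  = close-signed-b i₀ i (L∸[1+t]≡1 eq)
  depth-lipschitz i₀ (e-ub i _ L≡1)   = close-signed-b i₀ i L≡1
  depth-lipschitz i₀ (e-s'₀ i _ t t≡0) rewrite t≡0 = close-signed i₀ i (close-sym (close-∸1 L))
  depth-lipschitz i₀ (e-s' i _ t t′ eq) rewrite sym eq = close-signed i₀ i (close-∸ˡ L close-suc)
  depth-lipschitz i₀ (e-s'b i _ t eq) = close-signed-b i₀ i (L∸[1+t]≡1 eq)
  depth-lipschitz i₀ (e-u'b i _ L≡1)  = close-signed-b i₀ i L≡1

  -- In gadget i₀ the paths u′ and u and the vertices z, z′ form a cycle of length 2n + 2 on which
  -- u′_{i₀,a} and u_{i₀,a} are antipodal; elsewhere the spokes give the bound.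
  fromU′ : Fin k → ℕ → Vertex → ℕ
  fromU′ i₀ a b           = L
  fromU′ i₀ a (u' i j)    = ifSame i₀ i ∣ a - toℕ j ∣ (suc L)
  fromU′ i₀ a (u i j)     = ifSame i₀ i (suc n ∸ ∣ a - toℕ j ∣) (suc L)
  fromU′ i₀ a (z i)       = ifSame i₀ i (suc a) (suc L)
  fromU′ i₀ a (z' i)      = ifSame i₀ i (n ∸ a) (suc L)
  fromU′ i₀ a (pin i t)   = ifSame i₀ i ((suc n ∸ ∣ a - R ∣) + suc (toℕ t)) (suc L)
  fromU′ i₀ a (su i j t)  =
    ifSame i₀ i (((suc n ∸ ∣ a - toℕ j ∣) + suc (toℕ t)) ⊓ (L + (L ∸ suc (toℕ t)))) (suc L)
  fromU′ i₀ a (su' i j t) =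
    ifSame i₀ i ((∣ a - toℕ j ∣ + suc (toℕ t)) ⊓ (L + (L ∸ suc (toℕ t)))) (suc L)

  close-spoke-start : ∀ {x} → x ≤ L + L → Close x ((x + 1) ⊓ (L + (L ∸ 1)))
  close-spoke-start {x} x≤2L =
    ⊓-glb (≤-trans (n≤1+n x) (≤-trans (n≤1+n _) (s≤s (≤-reflexive (+-comm 1 x)))))
          (≤-trans x≤2L (≤-trans (+-monoʳ-≤ L (m≤n+m∸n L 1)) (≤-reflexive (+-suc L (L ∸ 1))))) ,
    ≤-trans (m⊓n≤m (x + 1) _) (≤-reflexive (+-comm x 1))

  close-spoke-end : ∀ {y} → L ∸ 1 ≤ y → Close (y ⊓ (L + 1)) L
  close-spoke-end {y} L∸1≤y =
    ≤-trans (m⊓n≤n y (L + 1)) (≤-reflexive (+-comm L 1)) ,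
    ⊓-glb (≤-trans (m≤n+m∸n L 1) (s≤s L∸1≤y))
          (≤-trans (n≤1+n L) (≤-trans (n≤1+n _) (s≤s (≤-reflexive (+-comm 1 L)))))

  close-spoke-direct : ∀ {x} → L ≡ 1 → x ≤ suc n → Close x L
  close-spoke-direct {x} refl x≤n+1 = subst (λ r → x ≤ suc (suc (r + r))) (L≡1⇒R≡0 refl) x≤n+1 , s≤s z≤n

  2+m∸[m∸a]≡2+a : ∀ m a → a ≤ m → suc (suc m) ∸ (m ∸ a) ≡ suc (suc a)
  2+m∸[m∸a]≡2+a m a a≤m = trans (+-∸-assoc 2 (m∸n≤m m a)) (cong (2 +_) (m∸[m∸n]≡n a≤m))

  fromU′-lipschitz : ∀ i₀ a → a ≤ R + R → Lipschitz (fromU′ i₀ a)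
  fromU′-lipschitz i₀ a a≤2R (e-u' i j j′ eq) rewrite sym eq =
    close-ifSame i₀ i (close-∣-suc∣ a (toℕ j)) close-refl
  fromU′-lipschitz i₀ a a≤2R (e-u i j j′ eq) rewrite sym eq =
    close-ifSame i₀ i (close-∸ˡ (suc n) (close-∣-suc∣ a (toℕ j))) close-refl
  fromU′-lipschitz i₀ a a≤2R (e-z₁ i j eq) rewrite eq | ∣-∣-identityʳ a =
    close-ifSame i₀ i (close-sym close-suc) close-refl
  fromU′-lipschitz i₀ a a≤2R (e-z₂ i j eq)
    rewrite suc-injective eq | m≤n⇒∣m-n∣≡n∸m a≤2R | 2+m∸[m∸a]≡2+a (R + R) a a≤2R =
    close-ifSame i₀ i close-suc close-refl
  fromU′-lipschitz i₀ a a≤2R (e-z'₁ i j eq)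
    rewrite suc-injective eq | m≤n⇒∣m-n∣≡n∸m a≤2R | +-∸-assoc 1 a≤2R =
    close-ifSame i₀ i (close-sym close-suc) close-refl
  fromU′-lipschitz i₀ a a≤2R (e-z'₂ i j eq)
    rewrite eq | ∣-∣-identityʳ a | +-∸-assoc 1 (m≤n⇒m≤1+n a≤2R) =
    close-ifSame i₀ i close-suc close-refl
  fromU′-lipschitz i₀ a a≤2R (e-p₀ i j t j-mid t≡0)
    rewrite j-mid | ⌊1+n+n/2⌋≡n R | t≡0 | +-comm (suc n ∸ ∣ a - R ∣) 1 =
    close-ifSame i₀ i close-suc close-refl
  fromU′-lipschitz i₀ a a≤2R (e-p i t t′ eq) rewrite sym eq =
    close-ifSame i₀ i (close-+ˡ (suc n ∸ ∣ a - R ∣) close-suc) close-refl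
  fromU′-lipschitz i₀ a a≤2R (e-s₀ i j t t≡0) rewrite t≡0 =
    close-ifSame i₀ i (close-spoke-start (≤-trans (m∸n≤m (suc n) ∣ a - toℕ j ∣) n+1≤L+L)) close-refl
  fromU′-lipschitz i₀ a a≤2R (e-s i j t t′ eq) rewrite sym eq = close-ifSame i₀ i
    (close-⊓ (close-+ˡ (suc n ∸ ∣ a - toℕ j ∣) close-suc) (close-+ˡ L (close-∸ˡ L close-suc))) close-refl
  fromU′-lipschitz i₀ a a≤2R (e-sb i j t eq) rewrite L∸[1+t]≡1 eq = close-ifSame-const i₀ i
    (close-spoke-end (≤-trans (≤-reflexive (sym eq)) (m≤n+m _ _))) (close-sym close-suc)
  fromU′-lipschitz i₀ a a≤2R (e-ub i j L≡1) = close-ifSame-const i₀ i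
    (close-spoke-direct L≡1 (m∸n≤m (suc n) ∣ a - toℕ j ∣)) (close-sym close-suc)
  fromU′-lipschitz i₀ a a≤2R (e-s'₀ i j t t≡0) rewrite t≡0 = close-ifSame i₀ i
    (close-spoke-start (≤-trans (∣a-j∣≤2R a j a≤2R) (≤-trans (n≤1+n _) (≤-trans (n≤1+n _) n+1≤L+L))))
    close-refl
  fromU′-lipschitz i₀ a a≤2R (e-s' i j t t′ eq) rewrite sym eq = close-ifSame i₀ i
    (close-⊓ (close-+ˡ ∣ a - toℕ j ∣ close-suc) (close-+ˡ L (close-∸ˡ L close-suc))) close-refl
  fromU′-lipschitz i₀ a a≤2R (e-s'b i j t eq) rewrite L∸[1+t]≡1 eq = close-ifSame-const i₀ i
    (close-spoke-end (≤-trans (≤-reflexive (sym eq)) (m≤n+m _ _))) (close-sym close-suc)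
  fromU′-lipschitz i₀ a a≤2R (e-u'b i j L≡1) = close-ifSame-const i₀ i
    (close-spoke-direct L≡1 (≤-trans (∣a-j∣≤2R a j a≤2R) (≤-trans (n≤1+n _) (n≤1+n _)))) (close-sym close-suc)

  toMid-u : ∀ i (c : Fin n) → toMid i (u i c) ≡ ∣ toℕ c - R ∣
  toMid-u i c = ifSame-refl i

  toMid-mid : ∀ i → toMid i (u i mid) ≡ 0
  toMid-mid i = trans (toMid-u i mid) (trans (cong (λ x → ∣ x - R ∣) toℕ-mid) (∣n-n∣≡0 R))

  fromP-pEnd : ∀ i → fromP i (pEnd Lp i mid) ≡ 0
  fromP-pEnd i with pEnd-cases {k} {n} {L} Lp i mid
  ... | inj₁ (pEnd≡u , Lp≡0) rewrite pEnd≡u = cong₂ _+_ Lp≡0 (toMid-mid i)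
  ... | inj₂ (t , pEnd≡pin , 1+t≡Lp) rewrite pEnd≡pin =
    trans (ifSame-refl i) (trans (cong (_∸ suc (toℕ t)) (sym 1+t≡Lp)) (n∸n≡0 (suc (toℕ t))))

  depth-u : ∀ i (c : Fin n) → depth i (u i c) ≡ L + L
  depth-u i c = ifSame-refl i

  depth-u′ : ∀ i (a : Fin n) → depth i (u' i a) ≡ L + L
  depth-u′ i a = ifSame-refl i

  depth-u′-other : ∀ {i j} (a : Fin n) → i ≢ j → depth i (u' j a) ≡ 0
  depth-u′-other a i≢j = trans (ifSame-≢ i≢j) (n∸n≡0 L)

  fromU′-u′ : ∀ i (a : Fin n) → fromU′ i (toℕ a) (u' i a) ≡ 0
  fromU′-u′ i a = trans (ifSame-refl i) (∣n-n∣≡0 (toℕ a))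

  fromU′-u : ∀ i (a c : Fin n) → fromU′ i (toℕ a) (u i c) ≡ suc n ∸ ∣ toℕ a - toℕ c ∣
  fromU′-u i a c = ifSame-refl i

  own-gadget : ∀ {i i′ : Fin k} {x} → ifSame i i′ x (suc R) ≤ R → i ≡ i′ × x ≤ R
  own-gadget {i} {i′} {x} = from-dec (i ≟ i′)
    where
    from-dec : (d : Dec (i ≡ i′)) → (if does d then x else suc R) ≤ R → i ≡ i′ × x ≤ R
    from-dec (yes i≡i′) x≤R   = i≡i′ , x≤R
    from-dec (no _)     1+R≤R = ⊥-elim (1+n≰n 1+R≤R)

  -- The possible servers of {p_i, u_{i,mid}}, each attached to a vertex u_{i,c} of U_i.
  data Candidate (i : Fin k) : Vertex → Fin n → Set where
    on-path   : ∀ c → Candidate i (u i c) c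
    on-spoke  : ∀ c t → ∣ toℕ c - R ∣ + suc (toℕ t) ≤ R → Candidate i (su i c t) c
    on-p-path : ∀ t → Candidate i (pin i t) mid

  Candidate-gadget : ∀ {i i′ w c c′} → Candidate i w c → Candidate i′ w c′ → i ≡ i′
  Candidate-gadget (on-path _)      (on-path _)      = refl
  Candidate-gadget (on-spoke _ _ _) (on-spoke _ _ _) = refl
  Candidate-gadget (on-p-path _)    (on-p-path _)    = refl

  depth-Candidate-other : ∀ {l i w c} → l ≢ i → Candidate l w c → depth i w ≤ R
  depth-Candidate-other l≢i (on-path c) =
    subst (_≤ R) (sym (trans (ifSame-≢ (l≢i ∘ sym)) (n∸n≡0 L))) z≤n
  depth-Candidate-other l≢i (on-spoke c t near) =
    subst (_≤ R) (sym (ifSame-≢ (l≢i ∘ sym))) (≤-trans (m∸[m∸n]≤n L (suc (toℕ t))) (≤-trans (m≤n+m _ _) near))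
  depth-Candidate-other l≢i (on-p-path t) =
    subst (_≤ R) (sym (trans (ifSame-≢ (l≢i ∘ sym)) (m≤n⇒m∸n≡0 (m≤m+n L _)))) z≤n

  spoke-bound : ∀ {s} → s ≤ R → suc n + (L + L) ≤ ((suc n + s) ⊓ (L + (L ∸ s))) + (L + (L ∸ s))
  spoke-bound {s} s≤R = begin
    suc n + (L + L)                               ≡⟨ cong (λ h → suc n + (L + h)) (m+[n∸m]≡n s≤L) ⟨
    suc n + (L + (s + (L ∸ s)))                   ≡⟨ interchange (suc n) L s (L ∸ s) ⟩
    (suc n + s) + (L + (L ∸ s))                   ≡⟨ cong (_+ (L + (L ∸ s))) (m≤n⇒m⊓n≡m n+1+s≤L+[L∸s]) ⟨
    ((suc n + s) ⊓ (L + (L ∸ s))) + (L + (L ∸ s)) ∎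
    where
    open ≤-Reasoning
    interchange : ∀ a b c d → a + (b + (c + d)) ≡ (a + c) + (b + d)
    interchange = solve-∀
    s≤L : s ≤ L
    s≤L = ≤-trans s≤R (≤-trans (m≤m+n R R) (≤-trans (n≤1+n _) n≤L))
    n+1+s≤L+[L∸s] : suc n + s ≤ L + (L ∸ s)
    n+1+s≤L+[L∸s] = subst (suc n + s ≤_) (+-∸-assoc L s≤L) (m+n≤o⇒m≤o∸n (suc n + s) (begin
      suc n + s + s   ≡⟨ +-assoc (suc n) s s ⟩
      suc n + (s + s) ≤⟨ +-monoʳ-≤ (suc n) (+-mono-≤ s≤R s≤R) ⟩
      suc n + (R + R) ≡⟨ +-suc n (R + R) ⟨
      n + n           ≤⟨ +-mono-≤ n≤L n≤L ⟩
      L + L           ∎))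

  -- At u_{i,a} itself the two bounds add up to exactly n + 1 + 2L: no candidate attached to u_{i,a}
  -- does better.
  Candidate-bound : ∀ {i w a} → Candidate i w a → suc n + (L + L) ≤ fromU′ i (toℕ a) w + depth i w
  Candidate-bound {i} (on-path a) rewrite ∣n-n∣≡0 (toℕ a) = ≤-reflexive (sym (cong₂ _+_ (ifSame-refl i) (ifSame-refl i)))
  Candidate-bound {i} (on-spoke a t near) rewrite ∣n-n∣≡0 (toℕ a) =
    ≤-trans (spoke-bound (≤-trans (m≤n+m _ _) near)) (≤-reflexive (sym (cong₂ _+_ (ifSame-refl i) (ifSame-refl i))))
  Candidate-bound {i} (on-p-path t) rewrite toℕ-mid | ∣n-n∣≡0 R =
    ≤-trans (+-mono-≤ (m≤m+n (suc n) (suc (toℕ t))) (+-monoʳ-≤ L (m≤m+n L (suc (toℕ t)))))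
            (≤-reflexive (sym (cong₂ _+_ (ifSame-refl i) (ifSame-refl i))))

  last : Fin n
  last = fromℕ (R + R)

  around-cycle : ∀ i (a c : Fin n) →
                 ∃ λ m → Walk {k} {n} {L} {Lp} (u' i a) (u i c) m × m ≤ suc n ∸ ∣ toℕ a - toℕ c ∣
  around-cycle i a c with ≤-total (toℕ a) (toℕ c)
  ... | inj₁ a≤c = _ , via-z , bound
    where
    via-z : Walk (u' i a) (u i c) (∣ toℕ a - 0 ∣ + suc (suc ∣ toℕ last - toℕ c ∣))
    via-z = u′-walk i a zero ++ʷ
      (inj₂ (e-z₁ i zero refl) ∷ inj₁ (e-z₂ i last (cong suc (toℕ-fromℕ (R + R)))) ∷ u-walk i last c)
    bound : ∣ toℕ a - 0 ∣ + suc (suc ∣ toℕ last - toℕ c ∣) ≤ suc n ∸ ∣ toℕ a - toℕ c ∣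
    bound rewrite ∣-∣-identityʳ (toℕ a) | toℕ-fromℕ (R + R) | m≤n⇒∣n-m∣≡n∸m (toℕ≤2R c) | m≤n⇒∣m-n∣≡n∸m a≤c =
      via-z-length a≤c (toℕ≤2R c)
  ... | inj₂ c≤a = _ , via-z′ , bound
    where
    via-z′ : Walk (u' i a) (u i c) (∣ toℕ a - toℕ last ∣ + suc (suc ∣ 0 - toℕ c ∣))
    via-z′ = u′-walk i a last ++ʷ
      (inj₂ (e-z'₁ i last (cong suc (toℕ-fromℕ (R + R)))) ∷ inj₁ (e-z'₂ i zero refl) ∷ u-walk i zero c)
    bound : ∣ toℕ a - toℕ last ∣ + suc (suc ∣ 0 - toℕ c ∣) ≤ suc n ∸ ∣ toℕ a - toℕ c ∣
    bound rewrite toℕ-fromℕ (R + R) | m≤n⇒∣m-n∣≡n∸m (toℕ≤2R a) | m≤n⇒∣n-m∣≡n∸m c≤a =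
      via-z′-length c≤a (toℕ≤2R a)

  module Serving (p q : ℕ) (p>0 : 0 < p) (2p≤q : 2 * p ≤ q) (qn≤2pL : q * n ≤ 2 * p * L)
                 (q[n∸1]≤pLp : q * (R + R) ≤ p * Lp) (pLp<qn : p * Lp < q * n) where

    p-terminal-dist : ∀ i → Dist (pEnd Lp i mid) (u i mid) Lp
    p-terminal-dist i = shortest-from (fromP-lipschitz i) (p-walk Lp i mid mid-is-middle) (fromP-pEnd i)
      (≤-reflexive (sym (trans (cong (Lp +_) (toMid-mid i)) (+-identityʳ Lp))))

    u-serves-p-terminal : ∀ i c → Serves p q (pEnd Lp i mid) (u i mid) (u i c)
    u-serves-p-terminal i c =
      Lp + ∣ toℕ c - R ∣ , ∣ toℕ c - R ∣ , Lp , p~c , c~mid , p-terminal-dist i ,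
      stretch-to-middle {p} {q} (∣j-R∣≤R c) ≤-refl q[n∸1]≤pLp
      where
      mid→c : Walk (u i mid) (u i c) ∣ toℕ c - R ∣
      mid→c = subst (Walk _ _) (trans (cong (λ x → ∣ x - toℕ c ∣) toℕ-mid) (∣-∣-comm R (toℕ c)))
                (u-walk i mid c)
      p~c : Dist (pEnd Lp i mid) (u i c) (Lp + ∣ toℕ c - R ∣)
      p~c = shortest-from (fromP-lipschitz i) (p-walk Lp i mid mid-is-middle ++ʷ mid→c) (fromP-pEnd i)
        (≤-reflexive (cong (Lp +_) (sym (toMid-u i c))))
      c~mid : Dist (u i c) (u i mid) ∣ toℕ c - R ∣
      c~mid = shortest-to (toMid-lipschitz i) (reverseʷ mid→c) (toMid-mid i) (≤-reflexive (sym (toMid-u i c)))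

    p-server-near-mid : ∀ i w → fromP i w ≡ Lp + toMid i w →
                        Serves p q (pEnd Lp i mid) (u i mid) w → toMid i w ≤ R
    p-server-near-mid i w fromP≡ (a , c , e , p~w , w~mid , p~mid , stretch) =
      stretch-at-middle {p} {q} Lp+toMid≤a toMid≤c e≤Lp stretch pLp<qn
      where
      Lp+toMid≤a : Lp + toMid i w ≤ a
      Lp+toMid≤a = subst (_≤ a) fromP≡ (walk-length-≥ʳ (fromP-lipschitz i) (proj₁ p~w) (fromP-pEnd i))
      toMid≤c : toMid i w ≤ c
      toMid≤c = walk-length-≥ (toMid-lipschitz i) (proj₁ w~mid) (toMid-mid i)
      e≤Lp : e ≤ Lp
      e≤Lp = Dist-minimal p~mid (p-walk Lp i mid mid-is-middle)

    p-server-Candidate : ∀ i w → Serves p q (pEnd Lp i mid) (u i mid) w → ∃ (Candidate i w)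
    p-server-Candidate i (u i′ c) srv with own-gadget {i} {i′} (p-server-near-mid i _ refl srv)
    ... | refl , _ = c , on-path c
    p-server-Candidate i (su i′ c t) srv with own-gadget {i} {i′} (p-server-near-mid i _ refl srv)
    ... | refl , near = c , on-spoke c t (m⊓1+n≤n⇒m≤n _ R near)
    p-server-Candidate i (pin i′ t) srv with i ≟ i′
    ... | yes refl = mid , on-p-path t
    ... | no i≢i′  = ⊥-elim (1+n≰n (subst (_≤ R) (ifSame-≢ i≢i′) (p-server-near-mid i _ fromP≡ srv)))
      where
      fromP≡ : fromP i (pin i′ t) ≡ Lp + toMid i (pin i′ t)
      fromP≡ = trans (ifSame-≢ i≢i′) (cong (Lp +_) (sym (ifSame-≢ i≢i′)))
    p-server-Candidate i b             srv = ⊥-elim (1+n≰n (p-server-near-mid i _ refl srv))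
    p-server-Candidate i (u' _ _)      srv = ⊥-elim (1+n≰n (p-server-near-mid i _ refl srv))
    p-server-Candidate i (z _)         srv = ⊥-elim (1+n≰n (p-server-near-mid i _ refl srv))
    p-server-Candidate i (z' _)        srv = ⊥-elim (1+n≰n (p-server-near-mid i _ refl srv))
    p-server-Candidate i (su' _ _ _)   srv = ⊥-elim (1+n≰n (p-server-near-mid i _ refl srv))

    no-server-elsewhere : ∀ {i j l a a′ w c} → l ≢ i → l ≢ j → Candidate l w c →
                          ¬ Serves p q (u' i a) (u' j a′) w
    no-server-elsewhere {i} {j} {l} {a} {a′} {w} l≢i l≢j cand (x , y , e , a~w , w~a′ , a~a′ , stretch) =
      stretch-no-detour {p} {q} q>0 2p≤q n≤L 2L≤x+depth 2L≤y+depth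
        (depth-Candidate-other l≢i cand) (depth-Candidate-other l≢j cand) e≤2L stretch
      where
      q>0 : 0 < q
      q>0 = ≤-trans p>0 (≤-trans (m≤m+n p (p + 0)) 2p≤q)
      2L≤x+depth : L + L ≤ x + depth i w
      2L≤x+depth = subst (_≤ x + depth i w) (depth-u′ i a) (lipschitz-walk (depth-lipschitz i) (proj₁ a~w))
      2L≤y+depth : L + L ≤ y + depth j w
      2L≤y+depth = subst (_≤ y + depth j w) (depth-u′ j a′)
        (lipschitz-walk (depth-lipschitz j) (reverseʷ (proj₁ w~a′)))
      e≤2L : e ≤ L + L
      e≤2L = Dist-minimal a~a′ (u′-spoke L 1≤L i a ++ʷ reverseʷ (u′-spoke L 1≤L j a′))

    replace-server : ∀ {i j a a′ w c} → i ≢ j → Candidate i w c →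
                     Serves p q (u' i a) (u' j a′) w → Serves p q (u' i a) (u' j a′) (u i c)
    replace-server {i} {j} {a} {a′} {w} {c} i≢j cand (x , y , e , a~w , w~a′ , a~a′ , stretch) =
      m , L + L , e , a~c , c~a′ , a~a′ , stretch′
      where
      around : ∃ λ m → Walk (u' i a) (u i c) m × m ≤ suc n ∸ ∣ toℕ a - toℕ c ∣
      around = around-cycle i a c
      m : ℕ
      m = proj₁ around
      m≤ : m ≤ suc n ∸ ∣ toℕ a - toℕ c ∣
      m≤ = proj₂ (proj₂ around)
      a~c : Dist (u' i a) (u i c) m
      a~c = shortest-from (fromU′-lipschitz i (toℕ a) (toℕ≤2R a)) (proj₁ (proj₂ around)) (fromU′-u′ i a)
        (≤-trans m≤ (≤-reflexive (sym (fromU′-u i a c))))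
      c~a′ : Dist (u i c) (u' j a′) (L + L)
      c~a′ = shortest-to (depth-lipschitz i) (u-spoke L 1≤L i c ++ʷ reverseʷ (u′-spoke L 1≤L j a′))
        (depth-u′-other a′ i≢j) (≤-reflexive (sym (depth-u i c)))
      stretch′ : q * (m + (L + L)) ≤ (q + p) * e
      stretch′ with a ≟ c
      ... | yes a≡c = ≤-trans (*-monoʳ-≤ q m+2L≤x+y) stretch
        where
        m+2L≤x+y : m + (L + L) ≤ x + y
        m+2L≤x+y = begin
          m + (L + L)                     ≤⟨ +-monoˡ-≤ (L + L) (≤-trans m≤ (m∸n≤m (suc n) ∣ toℕ a - toℕ c ∣)) ⟩
          suc n + (L + L)                 ≤⟨ Candidate-bound (subst (Candidate i w) (sym a≡c) cand) ⟩
          fromU′ i (toℕ a) w + depth i w  ≤⟨ +-mono-≤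
            (walk-length-≥ʳ (fromU′-lipschitz i (toℕ a) (toℕ≤2R a)) (proj₁ a~w) (fromU′-u′ i a))
            (walk-length-≥ (depth-lipschitz i) (proj₁ w~a′) (depth-u′-other a′ i≢j)) ⟩
          x + y                           ∎
          where open ≤-Reasoning
      ... | no a≢c = stretch-across {p} {q} m≤n 2L≤e qn≤2pL
        where
        0<∣a-c∣ : 0 < ∣ toℕ a - toℕ c ∣
        0<∣a-c∣ = n≢0⇒n>0 (a≢c ∘ toℕ-injective ∘ ∣m-n∣≡0⇒m≡n)
        m≤n : m ≤ n
        m≤n = ≤-trans m≤ (∸-monoʳ-≤ (suc n) 0<∣a-c∣)
        2L≤e : L + L ≤ e
        2L≤e = subst (_≤ e) (depth-u′ i a)
          (walk-length-≥ (depth-lipschitz i) (proj₁ a~a′) (depth-u′-other a′ i≢j))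

    module _ (EG : Fin k × Fin n → Fin k × Fin n → Set) (S : List Vertex) (|S|≤k : length S ≤ k)
             (sol : Solution EG p q S) where

      p-server : Fin k → Vertex
      p-server i = proj₁ (sol _ _ (t-p i mid mid-is-middle))

      p-server∈S : ∀ i → p-server i ∈ S
      p-server∈S i = proj₁ (proj₂ (sol _ _ (t-p i mid mid-is-middle)))

      p-server-attached : ∀ i → ∃ (Candidate i (p-server i))
      p-server-attached i = p-server-Candidate i _ (proj₂ (proj₂ (sol _ _ (t-p i mid mid-is-middle))))

      attached : Fin k → Fin n
      attached i = proj₁ (p-server-attached i)

      attached-Candidate : ∀ i → Candidate i (p-server i) (attached i)
      attached-Candidate i = proj₂ (p-server-attached i)

      p-server-injective : ∀ i i′ → p-server i ≡ p-server i′ → i ≡ i′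
      p-server-injective i i′ eq = Candidate-gadget (attached-Candidate i)
        (subst (λ w → Candidate i′ w (attached i′)) (sym eq) (attached-Candidate i′))

      chosen : Fin k → Vertex
      chosen i = u i (attached i)

      S* : List Vertex
      S* = map chosen (allFin k)

      chosen∈S* : ∀ i → chosen i ∈ S*
      chosen∈S* i = ∈-map⁺ chosen (∈-allFin i)

      S*-length : length S* ≤ k
      S*-length = ≤-reflexive (trans (length-map chosen (allFin k)) (length-tabulate id))

      S*-nice : Nice S*
      S*-nice = (λ i → attached i , chosen∈S* i , unique i) , λ w w∈S* → in-U (∈-map⁻ chosen w∈S*)
        where
        unique : ∀ i c → u i c ∈ S* → c ≡ attached i
        unique i c uic∈S* with ∈-map⁻ chosen uic∈S*
        ... | _ , _ , refl = refl
        in-U : ∀ {w} → ∃ (λ l → l ∈ allFin k × w ≡ chosen l) → ∃ λ i → ∃ λ c → w ≡ u i c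
        in-U (l , _ , w≡) = l , attached l , w≡

      edge-served-by-chosen : ∀ {i j a a′} → i ≢ j → ∀ l →
                              Serves p q (u' i a) (u' j a′) (p-server l) →
                              Serves p q (u' i a) (u' j a′) (chosen l)
      edge-served-by-chosen {i} {j} i≢j l srv with l ≟ i | l ≟ j
      ... | yes refl | _        = replace-server i≢j (attached-Candidate l) srv
      ... | no _     | yes refl = Serves-sym {p = p} {q = q}
        (replace-server (i≢j ∘ sym) (attached-Candidate l) (Serves-sym {p = p} {q = q} srv))
      ... | no l≢i   | no l≢j   = ⊥-elim (no-server-elsewhere l≢i l≢j (attached-Candidate l) srv)

      S*-solution : Solution EG p q S*
      S*-solution _ _ (t-p i j j-mid) with middle⇒≡mid j-mid
      ... | refl = chosen i , chosen∈S* i , u-serves-p-terminal i (attached i)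
      S*-solution _ _ (t-e i j a a′ i<j edge) with sol _ _ (t-e i j a a′ i<j edge)
      ... | w , w∈S , srv
        with short-list-⊆-injective-image S p-server p-server∈S p-server-injective |S|≤k w∈S
      ... | l , refl = chosen l , chosen∈S* l , edge-served-by-chosen (<⇒≢ i<j ∘ cong toℕ) l srv

      nice-solution : Σ (List Vertex) (λ S* → length S* ≤ k × Solution EG p q S* × Nice S*)
      nice-solution = S* , S*-length , S*-solution , S*-nice

lemma7 : (k n : ℕ) → n % 2 ≡ 1 →
         (p q : ℕ) → 0 < p → 2 * p ≤ q →
         (EG : Fin k × Fin n → Fin k × Fin n → Set) →
         (S : List (V' k n p q)) → length S ≤ k → Solution EG p q S →
         Σ (List (V' k n p q)) (λ S* → length S* ≤ k × Solution EG p q S* × Nice S*)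
lemma7 k n n-odd p q p>0 2p≤q with odd-form n n-odd
... | R , refl = Gadget.Serving.nice-solution k R (Lof n′ p q) (Lpof n′ p q) (n≤Lof p>0 n′ 2p≤q)
  p q p>0 2p≤q (q*n≤2p*Lof p>0 n′) (q*[n∸1]≤p*Lpof p>0 n′) (p*Lpof<q*n p>0 (R + R) p≤q)
  where
  n′ : ℕ
  n′ = suc (R + R)
  p≤q : p ≤ q
  p≤q = ≤-trans (m≤m+n p (p + 0)) 2p≤q
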